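{- Let $G$ be the $n\times n$ toroidal chess graph with $n$ arbitrarily large, and let $1\le m<n$. Play Cops and Robbers on $G$ with a cop who is a chief and an $m$-speedy robber. The chief has a strategy guaranteeing that the robber never leaves the row he originally occupies without being captured.
   Context: The $n\times n$ toroidal chess graph has vertex set $\mathbb{Z}_n\times\mathbb{Z}_n$, where $(i,j)$ is row $i$, column $j$; indices are taken mod $n$. The paper assumes throughout this part that $n$ is arbitrarily large. Cops and Robbers with one robber is played as follows. The cops choose starting vertices, then the robber chooses a starting vertex. After that the cops and the robber alternate turns, cops first. On the cops' turn, each cop either stays or moves to one of its allowable vertices. On the robber's turn, the robber either stays or moves to one of his allowable vertices. The robber is captured when a cop occupies his vertex. A cop is a chief if its allowable vertices are all other vertices in the same row, the same column, or the same (wrapping) diagonal as its current vertex. A player is $m$-speedy if its allowable vertices are the vertices in the same row or the same column at distance at most $m$ from its current vertex. Thus from $(i,j)$ it may move to $(i,j\pm t)$ or $(i\pm t,j)$ for $1\le t\le m$. -}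

module Defs where

open import Data.Nat using (ℕ; zero; suc; _+_; _*_; _≤_; _<_)
open import Data.Fin using (Fin; toℕ)
open import Data.Product using (_×_; _,_; proj₁; proj₂; ∃; ∃-syntax)
open import Data.Sum using (_⊎_)
open import Relation.Binary.PropositionalEquality using (_≡_; _≢_)

ModEq : ℕ → ℕ → ℕ → Set
ModEq n a b = ∃[ k ] (a ≡ b + k * n ⊎ b ≡ a + k * n)

-- Vertices of the n×n toroidal chess graph: (row , column) ∈ ℤₙ × ℤₙ.
Vertex : ℕ → Set
Vertex n = Fin n × Fin n

row : ∀ {n} → Vertex n → Fin n
row = proj₁

col : ∀ {n} → Vertex n → Fin n
col = proj₂

-- Allowable vertices of a chief at u: all *other* vertices in the same row,
-- the same column, or the same wrapping diagonal (either direction).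
ChiefMove : ∀ {n} → Vertex n → Vertex n → Set
ChiefMove {n} (i , j) (i' , j') =
  (i , j) ≢ (i' , j') ×
  ( i ≡ i'
  ⊎ j ≡ j'
  ⊎ ModEq n (toℕ i + toℕ j') (toℕ i' + toℕ j)
  ⊎ ModEq n (toℕ i + toℕ j) (toℕ i' + toℕ j'))

SpeedyMove : ∀ {n} → ℕ → Vertex n → Vertex n → Set
SpeedyMove {n} m (i , j) (i' , j') =
  ∃[ t ] (1 ≤ t × t ≤ m ×
    ( (i ≡ i' × (ModEq n (toℕ j') (toℕ j + t) ⊎ ModEq n (toℕ j) (toℕ j' + t)))
    ⊎ (j ≡ j' × (ModEq n (toℕ i') (toℕ i + t) ⊎ ModEq n (toℕ i) (toℕ i' + t)))))

-- A robber play: sequence of robber positions r 0 (start), r 1, r 2, ...,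
-- where r (suc k) is the robber's position after his move in round k+1.
-- Legal for an m-speedy robber: each step stays or is an allowable move.
LegalSpeedyPlay : ∀ {n} → ℕ → (ℕ → Vertex n) → Set
LegalSpeedyPlay m r = ∀ k → r (suc k) ≡ r k ⊎ SpeedyMove m (r k) (r (suc k))

-- A (deterministic) strategy for a single cop: a starting vertex, and for each
-- round k+1 a move depending on the robber's positions r 0 , … , r k
-- (the cop's own earlier positions are determined by the strategy itself).
record CopStrategy (n : ℕ) : Set where
  field
    start : Vertex n
    next  : (k : ℕ) → (Fin (suc k) → Vertex n) → Vertex n
open CopStrategy public

-- Cop positions induced by a strategy against a robber play:
-- cops σ r 0 is the cop start; cops σ r (suc k) is the cop position after
-- the cop's move in round k+1 (made when the robber stands on r k).
cops : ∀ {n} → CopStrategy n → (ℕ → Vertex n) → ℕ → Vertex n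
cops σ r zero    = start σ
cops σ r (suc k) = next σ k (λ i → r (toℕ i))

LegalChiefStrategy : ∀ {n} → ℕ → CopStrategy n → Set
LegalChiefStrategy m σ =
  ∀ r → LegalSpeedyPlay m r → ∀ k →
    cops σ r (suc k) ≡ cops σ r k ⊎ ChiefMove (cops σ r k) (cops σ r (suc k))

-- The robber standing on r j is captured: either the cop already occupies
-- that vertex (initially, or because the robber moved onto the cop), or
-- the cop moves onto it in the following cop turn.
CaughtAt : ∀ {n} → CopStrategy n → (ℕ → Vertex n) → ℕ → Set
CaughtAt σ r j = cops σ r j ≡ r j ⊎ cops σ r (suc j) ≡ r j

NeverLeavesRow : ∀ {n} → CopStrategy n → (ℕ → Vertex n) → Set
NeverLeavesRow σ r =
  ∀ k → row (r k) ≢ row (r 0) → ∃[ j ] (j ≤ k × CaughtAt σ r j)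

module Submission where

-- Idea: the chief shadows the robber's column.  After every cop turn the cop
-- stands in the column the robber occupied; to do so it moves along its row,
-- or, if the robber already shares its column, straight onto the robber.
-- An m-speedy robber moves along a row or a column.  A row move keeps him in
-- his row; a column move keeps him in the cop's column, so the cop captures
-- him on its next turn.  Hence he can never stand off his row uncaught.

open import Defs
open import Data.Nat using (ℕ; zero; suc; _+_; _≤_; _<_)
open import Data.Nat.Properties using (≤-refl; m≤n⇒m≤1+n)
open import Data.Fin using (Fin; toℕ) renaming (zero to fzero)
open import Data.Fin.Properties using (_≟_)
open import Data.Product using (_×_; ∃-syntax; _,_)
open import Data.Product.Properties using (≡-dec)
open import Data.Sum using (_⊎_; inj₁; inj₂)
open import Data.Empty using (⊥-elim)
open import Function using (_∘_)
open import Relation.Nullary using (yes; no)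
open import Relation.Binary.PropositionalEquality using (_≡_; refl; sym; trans; cong; subst)

SameLine : ∀ {n} → Vertex n → Vertex n → Set
SameLine u v = row u ≡ row v ⊎ col u ≡ col v

sameLine⇒chiefTurn : ∀ {n} (u v : Vertex n) → SameLine u v → v ≡ u ⊎ ChiefMove u v
sameLine⇒chiefTurn {n} (i , j) (i' , j') line with ≡-dec _≟_ _≟_ (i' , j') (i , j)
... | yes stay = inj₁ stay
... | no moved = inj₂ (moved ∘ sym , viaLine line)
  where
  viaLine : SameLine (i , j) (i' , j') →
            i ≡ i' ⊎ j ≡ j' ⊎ ModEq n (toℕ i + toℕ j') (toℕ i' + toℕ j)
                           ⊎ ModEq n (toℕ i + toℕ j) (toℕ i' + toℕ j')
  viaLine (inj₁ sameRow) = inj₁ sameRow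
  viaLine (inj₂ sameCol) = inj₂ (inj₁ sameCol)

speedy⇒sameLine : ∀ {n} m (u v : Vertex n) → SpeedyMove m u v → SameLine u v
speedy⇒sameLine m u v (_ , _ , _ , inj₁ (sameRow , _)) = inj₁ sameRow
speedy⇒sameLine m u v (_ , _ , _ , inj₂ (sameCol , _)) = inj₂ sameCol

robberStep : ∀ {n m} {r : ℕ → Vertex n} → LegalSpeedyPlay m r →
             ∀ k → SameLine (r k) (r (suc k))
robberStep {m = m} {r} legal k with legal k
... | inj₁ stay = inj₁ (cong row (sym stay))
... | inj₂ move = speedy⇒sameLine m (r k) (r (suc k)) move

module Positional {n : ℕ} (react : Vertex n → Vertex n → Vertex n) where

  run : Vertex n → (ℕ → Vertex n) → ℕ → Vertex n
  run s g zero    = s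
  run s g (suc k) = react (run s g k) (g k)

  replay : Vertex n → (k : ℕ) → (Fin (suc k) → Vertex n) → Vertex n
  replay s zero    h = react s (h fzero)
  replay s (suc k) h = replay (react s (h fzero)) k (h ∘ Fin.suc)

  strategy : Vertex n → CopStrategy n
  strategy s = record { start = s ; next = replay s }

  run-shift : ∀ s g k → run s g (suc k) ≡ run (react s (g 0)) (g ∘ suc) k
  run-shift s g zero    = refl
  run-shift s g (suc k) = cong (λ c → react c (g (suc k))) (run-shift s g k)

  replay-run : ∀ s g k → replay s k (g ∘ toℕ) ≡ run s g (suc k)
  replay-run s g zero    = refl
  replay-run s g (suc k) =
    trans (replay-run (react s (g 0)) (g ∘ suc) k) (sym (run-shift s g (suc k)))

  cops≡run : ∀ s g k → cops (strategy s) g k ≡ run s g k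
  cops≡run s g zero    = refl
  cops≡run s g (suc k) = replay-run s g k

  copTurn : ∀ s g k → cops (strategy s) g (suc k) ≡ react (cops (strategy s) g k) (g k)
  copTurn s g k =
    trans (cops≡run s g (suc k)) (cong (λ c → react c (g k)) (sym (cops≡run s g k)))

shadow : ∀ {n} → Vertex n → Vertex n → Vertex n
shadow (i , j) (i' , j') with j' ≟ j
... | yes _ = (i' , j')
... | no _  = (i , j')

shadow-col : ∀ {n} (c v : Vertex n) → col (shadow c v) ≡ col v
shadow-col (i , j) (i' , j') with j' ≟ j
... | yes _ = refl
... | no _  = refl

shadow-captures : ∀ {n} (c v : Vertex n) → col c ≡ col v → shadow c v ≡ v
shadow-captures (i , j) (i' , j') sameCol with j' ≟ j
... | yes _    = refl
... | no other = ⊥-elim (other (sym sameCol))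

shadow-sameLine : ∀ {n} (c v : Vertex n) → SameLine c (shadow c v)
shadow-sameLine (i , j) (i' , j') with j' ≟ j
... | yes sameCol = inj₂ (sym sameCol)
... | no _        = inj₁ refl

module Shadowing (n : ℕ) where
  open Positional {suc n} shadow using (strategy; copTurn)

  σ : CopStrategy (suc n)
  σ = strategy (fzero , fzero)

  legal : ∀ m → LegalChiefStrategy m σ
  legal m r _ k =
    subst (λ c → c ≡ cops σ r k ⊎ ChiefMove (cops σ r k) c) (sym (copTurn _ r k))
      (sameLine⇒chiefTurn (cops σ r k) _ (shadow-sameLine (cops σ r k) (r k)))

  inRobberCol : ∀ r k → col (cops σ r (suc k)) ≡ col (r k)
  inRobberCol r k = trans (cong col (copTurn _ r k)) (shadow-col _ (r k))

  CaughtBy : (ℕ → Vertex (suc n)) → ℕ → Set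
  CaughtBy r k = ∃[ j ] (j ≤ k × CaughtAt σ r j)

  columnMoveCaught : ∀ r k → col (r k) ≡ col (r (suc k)) → CaughtAt σ r (suc k)
  columnMoveCaught r k sameCol =
    inj₂ (trans (copTurn _ r (suc k))
                (shadow-captures _ (r (suc k)) (trans (inRobberCol r k) sameCol)))

  caughtOrHome : ∀ {m} r → LegalSpeedyPlay m r → ∀ k → CaughtBy r k ⊎ row (r k) ≡ row (r 0)
  caughtOrHome r legal zero = inj₂ refl
  caughtOrHome r legal (suc k) with robberStep legal k | caughtOrHome r legal k
  ... | inj₂ sameCol | _                   = inj₁ (suc k , ≤-refl , columnMoveCaught r k sameCol)
  ... | inj₁ _       | inj₁ (j , j≤k , c)  = inj₁ (j , m≤n⇒m≤1+n j≤k , c)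
  ... | inj₁ sameRow | inj₂ home           = inj₂ (trans (sym sameRow) home)

  neverLeaves : ∀ {m} r → LegalSpeedyPlay m r → NeverLeavesRow σ r
  neverLeaves r legal k left with caughtOrHome r legal k
  ... | inj₁ caught = caught
  ... | inj₂ home   = ⊥-elim (left home)

lemma3 : (n m : ℕ) → 1 ≤ m → m < n →
    ∃[ σ ] (LegalChiefStrategy {n} m σ ×
      (∀ r → LegalSpeedyPlay m r → NeverLeavesRow σ r))
lemma3 (suc n) m _ _ = σ , legal m , neverLeaves
  where open Shadowing n
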